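{- Up to reordering of the terms, the only $(6,4)$-sequences that are not G-sequences are $(7,4,2,2)$, $(7,3,3,2)$, $(6,3,3,3)$ and $(4,4,4,3)$. Up to reordering, the only $(7,4)$-sequence that is not a G-sequence is $(9,4,4,4)$.
   Context: A Gallai coloring (G-coloring) of $K_n$ is an edge coloring of $K_n$ with no triangle whose three edges receive three different colors. An $(n,k)$-sequence is a sequence $e_1,\dots,e_k$ of nonnegative integers with $\sum_{i=1}^k e_i=\binom{n}{2}$; it is a G-sequence if there is a G-coloring of $K_n$ with colors $1,\dots,k$ in which exactly $e_i$ edges have color $i$ for each $i$. -}

module Defs where

open import Data.Nat using (ℕ; _<_)
open import Data.Nat.Combinatorics using (_C_)
open import Data.Fin using (Fin; toℕ)
open import Data.Fin.Properties using (_≟_)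
open import Data.Nat.ListAction using (sum)
open import Data.List using (List; []; _∷_; filter; length; allFin; concatMap; tabulate)
open import Data.List.Relation.Binary.Permutation.Propositional using (_↭_)
open import Data.Product using (Σ; _×_; _,_)
open import Relation.Binary.PropositionalEquality using (_≡_; _≢_)
open import Relation.Nullary using (¬_)
import Data.Nat.Properties as ℕP

-- An edge colouring of K_n with colours 1..k (represented by Fin k):
-- a function on ordered pairs of vertices, symmetric on distinct pairs
-- (the value on the diagonal is irrelevant).
record Colouring (n k : ℕ) : Set where
  field
    col : Fin n → Fin n → Fin k
    sym : ∀ u v → u ≢ v → col u v ≡ col v u
open Colouring public

IsGallai : ∀ {n k} → Colouring n k → Set
IsGallai {n} c = ∀ (u v w : Fin n) → u ≢ v → v ≢ w → u ≢ w →
  ¬ (col c u v ≢ col c v w × col c v w ≢ col c u w × col c u v ≢ col c u w)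

edges : (n : ℕ) → List (Fin n × Fin n)
edges n = concatMap (λ u → filter (λ p → toℕ (Data.Product.proj₁ p) ℕP.<? toℕ (Data.Product.proj₂ p))
                                    (tabulate (λ v → (u , v))))
                    (allFin n)
  where import Data.Product

count : ∀ {n k} → Colouring n k → Fin k → ℕ
count {n} c i = length (filter (λ p → col c (Data.Product.proj₁ p) (Data.Product.proj₂ p) ≟ i) (edges n))
  where import Data.Product

IsSeq : (n k : ℕ) → (Fin k → ℕ) → Set
IsSeq n k e = sum (tabulate e) ≡ n C 2

IsGSeq : (n k : ℕ) → (Fin k → ℕ) → Set
IsGSeq n k e = Σ (Colouring n k) λ c → IsGallai c × (∀ i → count c i ≡ e i)

_≈reorder_ : ∀ {k} → (Fin k → ℕ) → List ℕ → Set
e ≈reorder l = tabulate e ↭ l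
infix 4 _≈reorder_

-- Whether a sequence is a G-sequence depends only on its multiset of entries: if two
-- orderings differ by a permutation of the positions, recolouring by that permutation
-- transports one colouring to the other.  So only the non-decreasing sequences need to
-- be examined, and there are finitely many.  Every non-exceptional one is realised by a
-- Gallai colouring that a backtracking search finds and that is then checked directly.
-- Every exception is refuted by running the same search to exhaustion: a Gallai
-- colouring with the prescribed colour counts passes all of the search's tests (no
-- rainbow triangle, no colour over budget) along its own branch, so the search would
-- have found it.
module Submission where

open import Defs
open import Data.Nat using (ℕ; zero; suc; _+_; _∸_; _≤_; _<ᵇ_; _⊓_; _⊔_; z≤n; s≤s; pred)
import Data.Nat.Properties as ℕ
open import Data.Nat.ListAction using (sum)
open import Data.Nat.ListAction.Properties using (sum-↭)
open import Data.Nat.Combinatorics using (_C_)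
open import Data.Bool using (Bool; true; _∧_; if_then_else_)
open import Data.Fin using (Fin; zero; suc; toℕ)
open import Data.Fin.Properties using (_≟_; all?)
open import Data.Fin.Permutation using (Permutation; _⟨$⟩ʳ_; _⟨$⟩ˡ_; inverseˡ; inverseʳ; flip; _∘ₚ_; cast-id)
open import Data.List using (List; []; _∷_; _++_; map; concatMap; filter; reverse; allFin; upTo; length; lookup; tabulate; drop; head)
open import Data.List.Properties using (length-tabulate; lookup-tabulate; tabulate-lookup; filter-accept; filter-reject; filter-≐; ≡-dec)
open import Data.List.Membership.Propositional using (_∈_; find; lose)
open import Data.List.Membership.Propositional.Properties using (∈-allFin; ∈-concatMap⁺; ∈-map⁺; ∈-filter⁺; ∈-upTo⁺)
open import Data.List.Relation.Unary.All as All using (All; []; _∷_)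
open import Data.List.Relation.Unary.All.Properties using (++⁻; map⁺)
open import Data.List.Relation.Unary.Any as Any using (Any; here; there; any?)
open import Data.List.Relation.Unary.Linked as Linked using ([]; [-]; _∷_)
open import Data.List.Relation.Unary.Linked.Properties using (Linked⇒All)
open import Data.List.Relation.Binary.Permutation.Propositional using (_↭_; ↭-sym; ↭-trans; ↭-reflexive; ↭⇒↭ₛ)
open import Data.List.Relation.Binary.Permutation.Propositional.Properties using (↭-length; filter-↭; ↭-reverse)
open import Data.List.Sort.Base ℕ.≤-totalOrder using (SortingAlgorithm)
open import Data.List.Sort.InsertionSort ℕ.≤-decTotalOrder using (insertionSort)
open import Data.List.Relation.Unary.Sorted.TotalOrder ℕ.≤-totalOrder using (Sorted)
open import Data.Vec as Vec using (Vec; updateAt)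
open import Data.Vec.Properties using (lookup∘updateAt; lookup∘updateAt′; lookup∘tabulate)
open import Data.Maybe using (Maybe; just; nothing; _<∣>_; _>>=_; fromMaybe; Is-just; to-witness)
import Data.Maybe as Maybe
import Data.Maybe.Relation.Unary.Any as MaybeAny
open import Data.Product using (_×_; _,_; proj₁; proj₂)
open import Data.Sum using (_⊎_; inj₁; inj₂)
open import Data.Unit using (tt)
open import Data.Empty using (⊥-elim)
open import Function using (_∘_; _⇔_; mk⇔; Equivalence)
import Function.Properties.Equivalence as ⇔
open import Relation.Nullary using (¬_; Dec; yes; no; does; ¬?)
open import Relation.Nullary.Decidable using (_×-dec_; _→-dec_; dec-true; dec⇒maybe; from-yes)
open import Relation.Binary.PropositionalEquality as ≡ using (_≡_; _≢_; refl; cong; cong₂; subst; subst₂)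
open ≡.≡-Reasoning

open SortingAlgorithm insertionSort using (sort; sort-↭; sort-↗)
open import Data.List.Relation.Binary.Permutation.Setoid (≡.setoid ℕ) using (onIndices)
open import Data.List.Relation.Binary.Permutation.Setoid.Properties (≡.setoid ℕ) using (onIndices-lookup)

module _ {n k k′ : ℕ} where

  recolour : (Fin k → Fin k′) → Colouring n k → Colouring n k′
  recolour σ c = record
    { col = λ u v → σ (col c u v)
    ; sym = λ u v u≢v → cong σ (Colouring.sym c u v u≢v)
    }

  -- a rainbow triangle after recolouring was already rainbow before
  recolour-Gallai : ∀ σ {c} → IsGallai c → IsGallai (recolour σ c)
  recolour-Gallai σ gallai u v w u≢v v≢w u≢w (h₁ , h₂ , h₃) =
    gallai u v w u≢v v≢w u≢w (h₁ ∘ cong σ , h₂ ∘ cong σ , h₃ ∘ cong σ)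

  count-recolour : (σ : Permutation k k′) (c : Colouring n k) (i : Fin k) →
                   count (recolour (σ ⟨$⟩ʳ_) c) (σ ⟨$⟩ʳ i) ≡ count c i
  count-recolour σ c i = cong length (filter-≐ (λ p → σ ⟨$⟩ʳ colour p ≟ σ ⟨$⟩ʳ i) (λ p → colour p ≟ i)
    (σ-injective , cong (σ ⟨$⟩ʳ_)) (edges n))
    where
    colour : Fin n × Fin n → Fin k
    colour (u , v) = col c u v
    σ-injective : ∀ {x y} → σ ⟨$⟩ʳ x ≡ σ ⟨$⟩ʳ y → x ≡ y
    σ-injective eq = ≡.trans (≡.sym (inverseˡ σ)) (≡.trans (cong (σ ⟨$⟩ˡ_) eq) (inverseˡ σ))

  IsGSeq-recolour : (σ : Permutation k k′) {e : Fin k → ℕ} {e′ : Fin k′ → ℕ} →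
                    (∀ i → e′ (σ ⟨$⟩ʳ i) ≡ e i) → IsGSeq n k e → IsGSeq n k′ e′
  IsGSeq-recolour σ {e} {e′} e′∘σ≗e (c , gallai , counts) =
    c′ , recolour-Gallai (σ ⟨$⟩ʳ_) {c} gallai , λ j → begin
      count c′ j                         ≡⟨ cong (count c′) (inverseʳ σ) ⟨
      count c′ (σ ⟨$⟩ʳ (σ ⟨$⟩ˡ j))      ≡⟨ count-recolour σ c _ ⟩
      count c (σ ⟨$⟩ˡ j)                 ≡⟨ counts _ ⟩
      e (σ ⟨$⟩ˡ j)                       ≡⟨ e′∘σ≗e _ ⟨
      e′ (σ ⟨$⟩ʳ (σ ⟨$⟩ˡ j))             ≡⟨ cong e′ (inverseʳ σ) ⟩
      e′ j                               ∎
    where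
    c′ : Colouring n k′
    c′ = recolour (σ ⟨$⟩ʳ_) c

IsGSeq-↭ : ∀ {n k k′} {e : Fin k → ℕ} {e′ : Fin k′ → ℕ} →
           tabulate e ↭ tabulate e′ → IsGSeq n k e → IsGSeq n k′ e′
IsGSeq-↭ {k = k} {k′} {e} {e′} e↭e′ = IsGSeq-recolour (τ ∘ₚ π ∘ₚ flip τ′) λ i → begin
  e′ (τ′ ⟨$⟩ˡ (π ⟨$⟩ʳ (τ ⟨$⟩ʳ i)))                           ≡⟨ lookup-tabulate e′ _ ⟨
  lookup (tabulate e′) (τ′ ⟨$⟩ʳ (τ′ ⟨$⟩ˡ (π ⟨$⟩ʳ (τ ⟨$⟩ʳ i)))) ≡⟨ cong (lookup (tabulate e′)) (inverseʳ τ′) ⟩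
  lookup (tabulate e′) (π ⟨$⟩ʳ (τ ⟨$⟩ʳ i))                    ≡⟨ onIndices-lookup (↭⇒↭ₛ e↭e′) _ ⟨
  lookup (tabulate e) (τ ⟨$⟩ʳ i)                               ≡⟨ lookup-tabulate e i ⟩
  e i                                                          ∎
  where
  index : ∀ {m} (f : Fin m → ℕ) → Permutation m (length (tabulate f))
  index f = cast-id (≡.sym (length-tabulate f))
  τ : Permutation k (length (tabulate e))
  τ = index e
  τ′ : Permutation k′ (length (tabulate e′))
  τ′ = index e′
  π : Permutation (length (tabulate e)) (length (tabulate e′))
  π = onIndices (↭⇒↭ₛ e↭e′)

IsGSeqˡ : ℕ → List ℕ → Set
IsGSeqˡ n xs = IsGSeq n (length xs) (lookup xs)

IsGSeq-↭ˡ : ∀ {n k} {e : Fin k → ℕ} {xs} → tabulate e ↭ xs → IsGSeq n k e → IsGSeqˡ n xs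
IsGSeq-↭ˡ {xs = xs} e↭xs = IsGSeq-↭ (↭-trans e↭xs (↭-reflexive (≡.sym (tabulate-lookup xs))))

IsGSeqˡ-↭ : ∀ {n k} {e : Fin k → ℕ} {xs} → xs ↭ tabulate e → IsGSeqˡ n xs → IsGSeq n k e
IsGSeqˡ-↭ {xs = xs} xs↭e = IsGSeq-↭ (↭-trans (↭-reflexive (tabulate-lookup xs)) xs↭e)

NotRainbow : ∀ {k} → Fin k × Fin k × Fin k → Set
NotRainbow (x , y , z) = ¬ (x ≢ y × y ≢ z × x ≢ z)

notRainbow? : ∀ {k} (t : Fin k × Fin k × Fin k) → Dec (NotRainbow t)
notRainbow? (x , y , z) = ¬? (¬? (x ≟ y) ×-dec ¬? (y ≟ z) ×-dec ¬? (x ≟ z))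

Distinct : ∀ {n} → Fin n × Fin n × Fin n → Set
Distinct (a , b , c) = a ≢ b × b ≢ c × a ≢ c

distinct? : ∀ {n} (t : Fin n × Fin n × Fin n) → Dec (Distinct t)
distinct? (a , b , c) = ¬? (a ≟ b) ×-dec ¬? (b ≟ c) ×-dec ¬? (a ≟ c)

triangleColours : ∀ {n k} → Colouring n k → Fin n × Fin n × Fin n → Fin k × Fin k × Fin k
triangleColours c (a , b , d) = col c a b , col c b d , col c a d

Gallai⇒NotRainbow : ∀ {n k} {c : Colouring n k} → IsGallai c → ∀ {t} → Distinct t → NotRainbow (triangleColours c t)
Gallai⇒NotRainbow gallai {a , b , d} (a≢b , b≢d , a≢d) = gallai a b d a≢b b≢d a≢d

firstJust : ∀ {A B : Set} → (A → Maybe B) → List A → Maybe B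
firstJust f [] = nothing
firstJust f (x ∷ xs) = f x <∣> firstJust f xs

firstJust-complete : ∀ {A B : Set} {f : A → Maybe B} {x xs} → x ∈ xs → Is-just (f x) → Is-just (firstJust f xs)
firstJust-complete {f = f} {xs = y ∷ _} (here refl) fx with f y
... | just _ = MaybeAny.just tt
firstJust-complete {f = f} {xs = y ∷ _} (there x∈ys) fx with f y
... | just _ = MaybeAny.just tt
... | nothing = firstJust-complete x∈ys fx

Is-just-map : ∀ {A B : Set} {f : A → B} {m : Maybe A} → Is-just m → Is-just (Maybe.map f m)
Is-just-map (MaybeAny.just _) = MaybeAny.just tt

edgeColour : ∀ {n k} → Colouring n k → Fin n × Fin n → Fin k
edgeColour c (u , v) = col c u v

above : ∀ {n} → Fin n → List (Fin n)
above b = filter (λ c → toℕ b ℕ.<? toℕ c) (allFin _)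

-- In this order the triangle (a , b , c), a < b < c, is completed by its edge (a , b).
searchOrder : ∀ n → List (Fin n × Fin n)
searchOrder n = reverse (edges n)

triangles : ∀ n → List (Fin n × Fin n × Fin n)
triangles n = concatMap (λ (a , b) → map (λ c → a , b , c) (above b)) (searchOrder n)

-- the position of the edge (u , v), u < v, in `edges n`
edgeIndex : ℕ → ℕ → ℕ → ℕ
edgeIndex n u v = offset u + (v ∸ suc u)
  where
  offset : ℕ → ℕ
  offset zero = 0
  offset (suc u) = offset u + (n ∸ suc u)

-- When (a , b) is coloured, the colours chosen so far are those of the later edges of
-- `edges n`, most recent first, so the edge with index j sits at position j ∸ suc i,
-- where i is the index of (a , b).
closingPositions : ∀ n → Fin n × Fin n → List (ℕ × ℕ)
closingPositions n (a , b) = map (λ c → position b c , position a c) (above b)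
  where
  position : Fin n → Fin n → ℕ
  position u v = edgeIndex n (toℕ u) (toℕ v) ∸ suc (edgeIndex n (toℕ a) (toℕ b))

plan : ℕ → List (List (ℕ × ℕ))
plan n = map (closingPositions n) (searchOrder n)

module _ {k : ℕ} where

  closing : List (Fin k) → Fin k → List (ℕ × ℕ) → List (Fin k × Fin k × Fin k)
  closing r x [] = []
  closing r x ((p , q) ∷ ps) with head (drop p r) | head (drop q r)
  ... | just y | just z = (x , y , z) ∷ closing r x ps
  ... | _      | _      = closing r x ps

  admissible : Vec ℕ k → List (Fin k) → List (ℕ × ℕ) → Fin k → Bool
  admissible budget r ps x = (0 <ᵇ Vec.lookup budget x) ∧ does (All.all? notRainbow? (closing r x ps))

  search : List (List (ℕ × ℕ)) → Vec ℕ k → List (Fin k) → Maybe (List (Fin k))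
  search [] budget r = just []
  search (ps ∷ pss) budget r = firstJust
    (λ x → if admissible budget r ps x
             then Maybe.map (x ∷_) (search pss (updateAt budget x pred) (x ∷ r))
             else nothing)
    (allFin k)

  constraints : List (List (ℕ × ℕ)) → List (Fin k) → List (Fin k) → List (Fin k × Fin k × Fin k)
  constraints (ps ∷ pss) r (x ∷ xs) = closing r x ps ++ constraints pss (x ∷ r) xs
  constraints _          r _        = []

  module _ {E : Set} (positions : E → List (ℕ × ℕ)) (colour : E → Fin k) where

    occurrences : Fin k → List E → ℕ
    occurrences i es = length (filter (λ e → colour e ≟ i) es)

    search-complete : ∀ es budget r →
      All NotRainbow (constraints (map positions es) r (map colour es)) →
      (∀ i → Vec.lookup budget i ≡ occurrences i es) →
      Is-just (search (map positions es) budget r)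
    search-complete [] budget r _ _ = MaybeAny.just tt
    search-complete (e ∷ es) budget r allowed counts =
      firstJust-complete (∈-allFin x)
        (subst (λ b → Is-just (if b then extension else nothing)) (≡.sym admissible-x)
          (Is-just-map (search-complete es budget′ (x ∷ r) (proj₂ split) counts′)))
      where
      x : Fin k
      x = colour e
      budget′ : Vec ℕ k
      budget′ = updateAt budget x pred
      extension : Maybe (List (Fin k))
      extension = Maybe.map (x ∷_) (search (map positions es) budget′ (x ∷ r))
      split : All NotRainbow (closing r x (positions e)) ×
              All NotRainbow (constraints (map positions es) (x ∷ r) (map colour es))
      split = ++⁻ (closing r x (positions e)) allowed
      budget-x : Vec.lookup budget x ≡ suc (occurrences x es)
      budget-x = ≡.trans (counts x) (cong length (filter-accept (λ e → colour e ≟ x) refl))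
      admissible-x : admissible budget r (positions e) x ≡ true
      admissible-x rewrite budget-x = dec-true (All.all? notRainbow? _) (proj₁ split)
      counts′ : ∀ i → Vec.lookup budget′ i ≡ occurrences i es
      counts′ i with i ≟ x
      ... | yes refl = ≡.trans (lookup∘updateAt x budget) (cong pred budget-x)
      ... | no i≢x = ≡.trans (lookup∘updateAt′ i x i≢x budget)
                      (≡.trans (counts i) (cong length (filter-reject (λ e → colour e ≟ i) (i≢x ∘ ≡.sym))))

-- Checked by evaluation for each concrete n: the plan visits every triangle and its
-- positions point at the right edges.
PlanCorrect : ℕ → Set
PlanCorrect n = ∀ {k} (c : Colouring n k) →
  constraints (plan n) [] (map (edgeColour c) (searchOrder n)) ≡ map (triangleColours c) (triangles n)

search-refutes : ∀ {n k} {e : Fin k → ℕ} → PlanCorrect n → All Distinct (triangles n) →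
                 search (plan n) (Vec.tabulate e) [] ≡ nothing → ¬ IsGSeq n k e
search-refutes {n} {k} {e} plan-correct distinct failed (c , gallai , counts) =
  nothing-is-not-just (subst Is-just failed
    (search-complete (closingPositions n) (edgeColour c) (searchOrder n) (Vec.tabulate e) [] passes λ i → begin
      Vec.lookup (Vec.tabulate e) i ≡⟨ lookup∘tabulate e i ⟩
      e i                          ≡⟨ counts i ⟨
      count c i                    ≡⟨ ↭-length (filter-↭ (λ p → edgeColour c p ≟ i) (↭-reverse (edges n))) ⟨
      occurrences (closingPositions n) (edgeColour c) i (searchOrder n) ∎))
  where
  passes : All NotRainbow (constraints (plan n) [] (map (edgeColour c) (searchOrder n)))
  passes = subst (All NotRainbow) (≡.sym (plan-correct c)) (map⁺ (All.map (Gallai⇒NotRainbow {c = c} gallai) distinct))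
  nothing-is-not-just : ¬ Is-just {A = List (Fin k)} nothing
  nothing-is-not-just ()

-- `xs` lists the edge colours in search order; `d` is the junk colour of the diagonal.
fromEdgeColours : ∀ n {k} → Fin k → List (Fin k) → Colouring n k
fromEdgeColours n {k} d xs = record
  { col = λ u v → colourOf (toℕ u ⊓ toℕ v) (toℕ u ⊔ toℕ v)
  ; sym = λ u v _ → cong₂ colourOf (ℕ.⊓-comm (toℕ u) (toℕ v)) (ℕ.⊔-comm (toℕ u) (toℕ v))
  }
  where
  colourOf : ℕ → ℕ → Fin k
  colourOf u v = fromMaybe d (head (drop (edgeIndex n u v) (reverse xs)))

gallai? : ∀ {n k} (c : Colouring n k) → Dec (IsGallai c)
gallai? c = all? λ u → all? λ v → all? λ w →
  ¬? (u ≟ v) →-dec ¬? (v ≟ w) →-dec ¬? (u ≟ w) →-dec notRainbow? (col c u v , col c v w , col c u w)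

realises? : ∀ {n k} (c : Colouring n k) (e : Fin k → ℕ) → Dec (IsGallai c × (∀ i → count c i ≡ e i))
realises? c e = gallai? c ×-dec all? λ i → count c i ℕ.≟ e i

realise : ∀ n {k} (e : Fin (suc k) → ℕ) → Maybe (IsGSeq n (suc k) e)
realise n e = search (plan n) (Vec.tabulate e) [] >>= λ xs →
  let c = fromEdgeColours n zero xs in Maybe.map (c ,_) (dec⇒maybe (realises? c e))

realiseˡ : ∀ n xs → Maybe (IsGSeqˡ n xs)
realiseˡ n []       = nothing
realiseˡ n (x ∷ xs) = realise n (lookup (x ∷ xs))

ascending : ℕ → ℕ → ℕ → List (List ℕ)
ascending total   (suc k) lo =
  concatMap (λ x → map (x ∷_) (ascending (total ∸ x) k x)) (filter (lo ℕ.≤?_) (upTo (suc total)))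
ascending zero    zero    lo = [] ∷ []
ascending (suc _) zero    lo = []

ascending-complete : ∀ {lo xs} → Sorted xs → All (lo ≤_) xs → xs ∈ ascending (sum xs) (length xs) lo
ascending-complete {xs = []} _ _ = here refl
ascending-complete {lo} {x ∷ xs} sorted (lo≤x ∷ _) =
  ∈-concatMap⁺ (λ y → map (y ∷_) (ascending (x + sum xs ∸ y) (length xs) y))
    (lose (∈-filter⁺ (lo ℕ.≤?_) (∈-upTo⁺ (s≤s (ℕ.m≤m+n x (sum xs)))) lo≤x) (∈-map⁺ (x ∷_) xs∈))
  where
  bounded : ∀ {ys} → Sorted (x ∷ ys) → All (x ≤_) ys
  bounded [-] = []
  bounded (x≤y ∷ s) = Linked⇒All ℕ.≤-trans x≤y s
  xs∈ : xs ∈ ascending (x + sum xs ∸ x) (length xs) x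
  xs∈ = subst (λ t → xs ∈ ascending t (length xs) x) (≡.sym (ℕ.m+n∸m≡n x (sum xs)))
          (ascending-complete (Linked.tail sorted) (bounded sorted))

Settled : ℕ → List (List ℕ) → List ℕ → Set
Settled n exceptions s = Any (λ l → s ≡ sort l) exceptions ⊎ IsGSeqˡ n s

settle : ∀ n exceptions s → Maybe (Settled n exceptions s)
settle n exceptions s with any? (λ l → ≡-dec ℕ._≟_ s (sort l)) exceptions
... | yes matched = just (inj₁ matched)
... | no _        = Maybe.map inj₂ (realiseˡ n s)

classification : ∀ n {k} exceptions →
  All (λ l → ¬ IsGSeqˡ n l) exceptions →
  All (Is-just ∘ settle n exceptions) (ascending (n C 2) k 0) →
  ∀ e → IsSeq n k e → (¬ IsGSeq n k e) ⇔ Any (tabulate e ↭_) exceptions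
classification n {k} exceptions refuted settled e seq = mk⇔ non-G⇒exceptional exceptional⇒non-G
  where
  s : List ℕ
  s = sort (tabulate e)
  s↭e : s ↭ tabulate e
  s↭e = sort-↭ (tabulate e)
  s∈ascending : s ∈ ascending (n C 2) k 0
  s∈ascending = subst₂ (λ total len → s ∈ ascending total len 0)
    (≡.trans (sum-↭ s↭e) seq) (≡.trans (↭-length s↭e) (length-tabulate e))
    (ascending-complete (sort-↗ (tabulate e)) (All.universal (λ _ → z≤n) s))
  non-G⇒exceptional : ¬ IsGSeq n k e → Any (tabulate e ↭_) exceptions
  non-G⇒exceptional non-G with to-witness (All.lookup settled s∈ascending)
  ... | inj₁ matched = Any.map (λ {l} s≡l → ↭-trans (↭-sym s↭e) (subst (_↭ l) (≡.sym s≡l) (sort-↭ l))) matched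
  ... | inj₂ realised = ⊥-elim (non-G (IsGSeqˡ-↭ s↭e realised))
  exceptional⇒non-G : Any (tabulate e ↭_) exceptions → ¬ IsGSeq n k e
  exceptional⇒non-G exceptional g with find exceptional
  ... | l , l∈exceptions , e↭l = All.lookup refuted l∈exceptions (IsGSeq-↭ˡ e↭l g)

-- `Any P (x ∷ xs)` unfolded into P x ⊎ ⋯ ⊎ P xₙ, the shape used in the statement
Any⁺ : ∀ {A : Set} → (A → Set) → A → List A → Set
Any⁺ P x []       = P x
Any⁺ P x (y ∷ ys) = P x ⊎ Any⁺ P y ys

Any⇔Any⁺ : ∀ {A : Set} {P : A → Set} {x xs} → Any P (x ∷ xs) ⇔ Any⁺ P x xs
Any⇔Any⁺ {xs = []}     = mk⇔ (λ { (here p) → p ; (there ()) }) here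
Any⇔Any⁺ {P = P} {x} {y ∷ ys} = mk⇔ to from
  where
  to : Any P (x ∷ y ∷ ys) → Any⁺ P x (y ∷ ys)
  to (here p)  = inj₁ p
  to (there a) = inj₂ (Equivalence.to Any⇔Any⁺ a)
  from : Any⁺ P x (y ∷ ys) → Any P (x ∷ y ∷ ys)
  from (inj₁ p) = here p
  from (inj₂ a) = there (Equivalence.from Any⇔Any⁺ a)

exceptions₆ exceptions₇ : List (List ℕ)
exceptions₆ = (7 ∷ 4 ∷ 2 ∷ 2 ∷ []) ∷ (7 ∷ 3 ∷ 3 ∷ 2 ∷ []) ∷ (6 ∷ 3 ∷ 3 ∷ 3 ∷ []) ∷ (4 ∷ 4 ∷ 4 ∷ 3 ∷ []) ∷ []
exceptions₇ = (9 ∷ 4 ∷ 4 ∷ 4 ∷ []) ∷ []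

plan-correct₆ : PlanCorrect 6
plan-correct₆ c = refl

plan-correct₇ : PlanCorrect 7
plan-correct₇ c = refl

exceptions₆-refuted : All (λ l → ¬ IsGSeqˡ 6 l) exceptions₆
exceptions₆-refuted = refuted refl ∷ refuted refl ∷ refuted refl ∷ refuted refl ∷ []
  where
  refuted : ∀ {k} {e : Fin k → ℕ} → search (plan 6) (Vec.tabulate e) [] ≡ nothing → ¬ IsGSeq 6 k e
  refuted = search-refutes plan-correct₆ (from-yes (All.all? distinct? (triangles 6)))

exceptions₇-refuted : All (λ l → ¬ IsGSeqˡ 7 l) exceptions₇
exceptions₇-refuted = search-refutes plan-correct₇ (from-yes (All.all? distinct? (triangles 7))) refl ∷ []

settled₆ : All (Is-just ∘ settle 6 exceptions₆) (ascending 15 4 0)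
settled₆ = from-yes (All.all? (MaybeAny.dec (λ _ → yes tt) ∘ settle 6 exceptions₆) (ascending 15 4 0))

settled₇ : All (Is-just ∘ settle 7 exceptions₇) (ascending 21 4 0)
settled₇ = from-yes (All.all? (MaybeAny.dec (λ _ → yes tt) ∘ settle 7 exceptions₇) (ascending 21 4 0))

lemma4p1 :
    ((e : Fin 4 → ℕ) → IsSeq 6 4 e →
      ((¬ IsGSeq 6 4 e) ⇔
        (e ≈reorder (7 ∷ 4 ∷ 2 ∷ 2 ∷ []) ⊎ e ≈reorder (7 ∷ 3 ∷ 3 ∷ 2 ∷ [])
          ⊎ e ≈reorder (6 ∷ 3 ∷ 3 ∷ 3 ∷ []) ⊎ e ≈reorder (4 ∷ 4 ∷ 4 ∷ 3 ∷ []))))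
    × ((e : Fin 4 → ℕ) → IsSeq 7 4 e →
      ((¬ IsGSeq 7 4 e) ⇔ e ≈reorder (9 ∷ 4 ∷ 4 ∷ 4 ∷ [])))
lemma4p1 =
    (λ e seq → ⇔.trans (classification 6 exceptions₆ exceptions₆-refuted settled₆ e seq) Any⇔Any⁺)
  , (λ e seq → ⇔.trans (classification 7 exceptions₇ exceptions₇-refuted settled₇ e seq) Any⇔Any⁺)
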